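{- Let $q=2^s\prod_{i=1}^N p_i^{n_i}$ where $s\ge0$, the $p_i$ are distinct odd primes and $n_i\ge1$, and let $q_0=2^s\prod_{i=1}^N p_i$. Then $\Gamma(q_0)/\Gamma(q)=G(q_0)/G(q)$.
   Context: Let $\phi=\frac{1+\sqrt5}{2}$, and let $\Gamma\subset \mathrm{SL}_2(\mathbb Z[\phi])$ be the group generated by $\begin{pmatrix}1&\phi\\0&1\end{pmatrix}$, $\begin{pmatrix}1&0\\\phi&1\end{pmatrix}$, $\begin{pmatrix}\phi&\phi\\1&\phi\end{pmatrix}$, $\begin{pmatrix}\phi&1\\\phi&\phi\end{pmatrix}$. Let $G=\mathrm{SL}_2(\mathbb Z[\phi])$. For an integer $q\ge1$, let $\pi_q:G\to\mathrm{SL}_2(\mathbb Z[\phi]/q\mathbb Z[\phi])$ be reduction mod $q$, $G(q)=\ker\pi_q$, $\Gamma(q)=\Gamma\cap\ker\pi_q$. For $q_0\mid q$, $\Gamma(q_0)/\Gamma(q)$ and $G(q_0)/G(q)$ denote the images $\pi_q(\Gamma(q_0))$ and $\pi_q(G(q_0))$ in $\pi_q(G)$. -}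

module Defs where

open import Data.Nat as ℕ using (ℕ; zero; suc)
open import Data.Fin using (Fin; zero; suc)
open import Data.Integer as ℤ using (ℤ; +_; 0ℤ; 1ℤ)
open import Data.Integer.Divisibility using (_∣_)
open import Data.Product using (_×_)
open import Relation.Binary.PropositionalEquality using (_≡_)

-- Elements a + b φ of ℤ[φ], φ = (1+√5)/2, φ² = φ + 1.
-- The representation (a , b) is unique, so ≡ is the right equality.
record Zφ : Set where
  constructor _+_φ
  field
    re : ℤ
    ph : ℤ
open Zφ public

infixl 6 _⊕_ _⊖_
infixl 7 _⊗_

_⊕_ : Zφ → Zφ → Zφ
(a + b φ) ⊕ (c + d φ) = (a ℤ.+ c) + (b ℤ.+ d) φ

⊝_ : Zφ → Zφ
⊝ (a + b φ) = (ℤ.- a) + (ℤ.- b) φ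

_⊖_ : Zφ → Zφ → Zφ
x ⊖ y = x ⊕ (⊝ y)

_⊗_ : Zφ → Zφ → Zφ
(a + b φ) ⊗ (c + d φ) = (a ℤ.* c ℤ.+ b ℤ.* d) + (a ℤ.* d ℤ.+ b ℤ.* c ℤ.+ b ℤ.* d) φ

𝟘 𝟙 φ : Zφ
𝟘 = 0ℤ + 0ℤ φ
𝟙 = 1ℤ + 0ℤ φ
φ = 0ℤ + 1ℤ φ

-- x ≡ y mod q ℤ[φ]  (q ℤ[φ] = {qa + qbφ}, so componentwise divisibility)
_≡[φ]_mod_ : Zφ → Zφ → ℕ → Set
x ≡[φ] y mod q = ((+ q) ∣ (re x ℤ.- re y)) × ((+ q) ∣ (ph x ℤ.- ph y))

record M₂ : Set where
  constructor mat
  field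
    a b c d : Zφ
open M₂ public

I₂ : M₂
I₂ = mat 𝟙 𝟘 𝟘 𝟙

_·_ : M₂ → M₂ → M₂
mat a b c d · mat a' b' c' d' =
  mat (a ⊗ a' ⊕ b ⊗ c') (a ⊗ b' ⊕ b ⊗ d') (c ⊗ a' ⊕ d ⊗ c') (c ⊗ b' ⊕ d ⊗ d')

det : M₂ → Zφ
det (mat a b c d) = a ⊗ d ⊖ b ⊗ c

-- adjugate; it is the inverse for matrices of determinant 1
adj : M₂ → M₂
adj (mat a b c d) = mat d (⊝ b) (⊝ c) a

InG : M₂ → Set
InG g = det g ≡ 𝟙

g₁ g₂ g₃ g₄ : M₂
g₁ = mat 𝟙 φ 𝟘 𝟙
g₂ = mat 𝟙 𝟘 φ 𝟙
g₃ = mat φ φ 𝟙 φ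
g₄ = mat φ 𝟙 φ φ

data InΓ : M₂ → Set where
  gen₁ : InΓ g₁
  gen₂ : InΓ g₂
  gen₃ : InΓ g₃
  gen₄ : InΓ g₄
  one  : InΓ I₂
  mul  : ∀ {x y} → InΓ x → InΓ y → InΓ (x · y)
  inv  : ∀ {x} → InΓ x → InΓ (adj x)

-- entrywise congruence mod q, i.e. π_q x = π_q y
_≡M_mod_ : M₂ → M₂ → ℕ → Set
x ≡M y mod q =
  (a x ≡[φ] a y mod q) × (b x ≡[φ] b y mod q) ×
  (c x ≡[φ] c y mod q) × (d x ≡[φ] d y mod q)

∏ : (N : ℕ) → (Fin N → ℕ) → ℕ
∏ zero f = 1
∏ (suc N) f = f zero ℕ.* ∏ N (λ i → f (suc i))

{-# OPTIONS --safe #-}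
-- Put r = ∏ pᵢ, which is odd, so that r ∣ q₀.  Conjugating the powers E(nφ) of g₁ by γ ∈ Γ
-- gives I + m·(tφ)·γe₁₂γ⁻¹ ∈ Γ(m) for every t ∈ ℤ, and modulo m² such elements multiply by
-- adding their m-parts.  Six explicit conjugators show that the ℤ-span of the matrices
-- φ·γe₁₂γ⁻¹ contains twice every traceless matrix, hence (1 + r)X₀ for every traceless X₀.
-- If g = I + mX has determinant 1, then X ≡ X₀ (mod m) with X₀ traceless, so some γ ∈ Γ(m)
-- satisfies γ ≡ I + m(1 + r)X₀ ≡ I + mX₀ ≡ g (mod mr) whenever r ∣ m.  Replacing g by γ⁻¹g
-- and iterating K = ∑ nᵢ times gives γ ∈ Γ(q₀) with γ ≡ g (mod q₀rᴷ), and q ∣ q₀rᴷ.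
module Submission where

open import Defs
open import Data.Nat using (ℕ; _^_; _*_; _≤_)
open import Data.Nat.Divisibility using (_∣_)
open import Data.Nat.Primality using (Prime)
open import Data.Fin using (Fin)
open import Data.Product using (Σ; _×_)
open import Relation.Nullary using (¬_)
open import Relation.Binary.PropositionalEquality using (_≡_)
open import Function.Definitions using (Injective)

open import Algebra.Bundles using (CommutativeRing)
open import Algebra.Structures {A = Zφ} _≡_ using (IsCommutativeRing)
import Algebra.Properties.Group as GroupProperties
open import Data.Fin using (zero; suc)
open import Data.Integer using (ℤ; +_; -_; -[1+_]; 0ℤ; 1ℤ)
  renaming (_+_ to _+ℤ_; _*_ to _*ℤ_; _-_ to _-ℤ_)
import Data.Integer.Divisibility.Signed as ℤ∣
import Data.Integer.Properties as ℤ
open import Data.Integer.Tactic.RingSolver as ℤ-Solver using ()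
open import Data.Maybe using (Maybe; just; nothing)
open import Data.Nat as ℕ using (zero; suc; _∸_; NonZero; ≢-nonZero⁻¹; ⌈_/2⌉)
open import Data.Nat.Divisibility
  using (divides; ∣-refl; ∣-trans; _∣0; ∣1⇒≡1; 1∣_; ∣m∣n⇒∣m+n; m∣m*n; n∣m*n; *-pres-∣; *-monoʳ-∣)
open import Data.Nat.Primality using (euclidsLemma; prime[2])
import Data.Nat.Properties as ℕ
open import Data.Product using (_,_)
open import Data.Sum using (inj₁; inj₂)
open import Function using (_∘_; it)
open import Level using (0ℓ)
open import Relation.Binary.Bundles using (Setoid)
open import Relation.Binary.PropositionalEquality
  using (refl; sym; trans; cong; cong₂; subst; isEquivalence; module ≡-Reasoning)
import Relation.Binary.Reasoning.Setoid as SetoidReasoning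
open import Relation.Nullary using (contradiction)
open import Tactic.RingSolver using (solve-∀)
import Tactic.RingSolver.Core.AlmostCommutativeRing as ACR
open import Algebra.Properties.CommutativeSemigroup ℕ.*-commutativeSemigroup using (interchange)

private
  variable
    m n q : ℕ
    x x′ y y′ z A B : M₂

∑ : (N : ℕ) → (Fin N → ℕ) → ℕ
∑ zero    f = 0
∑ (suc N) f = f zero ℕ.+ ∑ N (f ∘ suc)

≤-∑ : ∀ N (f : Fin N → ℕ) i → f i ≤ ∑ N f
≤-∑ (suc N) f zero    = ℕ.m≤m+n (f zero) (∑ N (f ∘ suc))
≤-∑ (suc N) f (suc i) = ℕ.≤-trans (≤-∑ N (f ∘ suc) i) (ℕ.m≤n+m (∑ N (f ∘ suc)) (f zero))

∏-odd : ∀ N (p : Fin N → ℕ) → (∀ i → ¬ 2 ∣ p i) → ¬ 2 ∣ ∏ N p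
∏-odd zero    p _     2∣1 with () ← ∣1⇒≡1 2∣1
∏-odd (suc N) p p-odd 2∣∏ with euclidsLemma (p zero) (∏ N (p ∘ suc)) prime[2] 2∣∏
... | inj₁ 2∣p₀ = p-odd zero 2∣p₀
... | inj₂ 2∣∏′ = ∏-odd N (p ∘ suc) (p-odd ∘ suc) 2∣∏′

^-distribʳ-* : ∀ m n k → (m * n) ^ k ≡ m ^ k * n ^ k
^-distribʳ-* m n zero    = refl
^-distribʳ-* m n (suc k) = trans (cong (m * n *_) (^-distribʳ-* m n k)) (interchange m n (m ^ k) (n ^ k))

^-monoʳ-∣ : ∀ m {j k} → j ≤ k → m ^ j ∣ m ^ k
^-monoʳ-∣ m {j} {k} j≤k = subst (m ^ j ∣_) eq (m∣m*n (m ^ (k ∸ j)))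
  where
  eq : m ^ j * m ^ (k ∸ j) ≡ m ^ k
  eq = trans (sym (ℕ.^-distribˡ-+-* m j (k ∸ j))) (cong (m ^_) (ℕ.m+[n∸m]≡n j≤k))

∏-^-∣-∏-^ : ∀ N (p n : Fin N → ℕ) K → (∀ i → n i ≤ K) → ∏ N (λ i → p i ^ n i) ∣ ∏ N p ^ K
∏-^-∣-∏-^ zero    p n K _   = 1∣ _
∏-^-∣-∏-^ (suc N) p n K n≤K = subst (_ ∣_) (sym (^-distribʳ-* (p zero) (∏ N (p ∘ suc)) K))
  (*-pres-∣ (^-monoʳ-∣ (p zero) (n≤K zero)) (∏-^-∣-∏-^ N (p ∘ suc) (n ∘ suc) K (n≤K ∘ suc)))

odd⇒nonZero : ∀ {r} → ¬ 2 ∣ r → NonZero r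
odd⇒nonZero {zero}  r-odd = contradiction (2 ∣0) r-odd
odd⇒nonZero {suc r} _     = _

odd⇒suc≡⌈/2⌉*2 : ∀ {r} → ¬ 2 ∣ r → suc r ≡ ⌈ r /2⌉ * 2
odd⇒suc≡⌈/2⌉*2 {zero}        r-odd = contradiction (2 ∣0) r-odd
odd⇒suc≡⌈/2⌉*2 {suc zero}    _     = refl
odd⇒suc≡⌈/2⌉*2 {suc (suc r)} r-odd = cong (2 ℕ.+_) (odd⇒suc≡⌈/2⌉*2 (r-odd ∘ ∣m∣n⇒∣m+n ∣-refl))

⊕-assoc : ∀ x y z → (x ⊕ y) ⊕ z ≡ x ⊕ (y ⊕ z)
⊕-assoc (x₁ + x₂ φ) (y₁ + y₂ φ) (z₁ + z₂ φ) = cong₂ _+_φ (ℤ.+-assoc x₁ y₁ z₁) (ℤ.+-assoc x₂ y₂ z₂)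

⊕-comm : ∀ x y → x ⊕ y ≡ y ⊕ x
⊕-comm (x₁ + x₂ φ) (y₁ + y₂ φ) = cong₂ _+_φ (ℤ.+-comm x₁ y₁) (ℤ.+-comm x₂ y₂)

⊕-identityˡ : ∀ x → 𝟘 ⊕ x ≡ x
⊕-identityˡ (x₁ + x₂ φ) = cong₂ _+_φ (ℤ.+-identityˡ x₁) (ℤ.+-identityˡ x₂)

⊕-identityʳ : ∀ x → x ⊕ 𝟘 ≡ x
⊕-identityʳ (x₁ + x₂ φ) = cong₂ _+_φ (ℤ.+-identityʳ x₁) (ℤ.+-identityʳ x₂)

⊝-inverseˡ : ∀ x → (⊝ x) ⊕ x ≡ 𝟘
⊝-inverseˡ (x₁ + x₂ φ) = cong₂ _+_φ (ℤ.+-inverseˡ x₁) (ℤ.+-inverseˡ x₂)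

⊝-inverseʳ : ∀ x → x ⊕ (⊝ x) ≡ 𝟘
⊝-inverseʳ (x₁ + x₂ φ) = cong₂ _+_φ (ℤ.+-inverseʳ x₁) (ℤ.+-inverseʳ x₂)

⊗-assoc : ∀ x y z → (x ⊗ y) ⊗ z ≡ x ⊗ (y ⊗ z)
⊗-assoc (a + b φ) (c + d φ) (e + f φ) = cong₂ _+_φ (re-assoc a b c d e f) (ph-assoc a b c d e f)
  where
  re-assoc : ∀ a b c d e f →
    (a *ℤ c +ℤ b *ℤ d) *ℤ e +ℤ (a *ℤ d +ℤ b *ℤ c +ℤ b *ℤ d) *ℤ f ≡
    a *ℤ (c *ℤ e +ℤ d *ℤ f) +ℤ b *ℤ (c *ℤ f +ℤ d *ℤ e +ℤ d *ℤ f)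
  re-assoc = ℤ-Solver.solve-∀
  ph-assoc : ∀ a b c d e f →
    (a *ℤ c +ℤ b *ℤ d) *ℤ f +ℤ (a *ℤ d +ℤ b *ℤ c +ℤ b *ℤ d) *ℤ e +ℤ (a *ℤ d +ℤ b *ℤ c +ℤ b *ℤ d) *ℤ f ≡
    a *ℤ (c *ℤ f +ℤ d *ℤ e +ℤ d *ℤ f) +ℤ b *ℤ (c *ℤ e +ℤ d *ℤ f) +ℤ b *ℤ (c *ℤ f +ℤ d *ℤ e +ℤ d *ℤ f)
  ph-assoc = ℤ-Solver.solve-∀

⊗-comm : ∀ x y → x ⊗ y ≡ y ⊗ x
⊗-comm (a + b φ) (c + d φ) = cong₂ _+_φ (re-comm a b c d) (ph-comm a b c d)
  where
  re-comm : ∀ a b c d → a *ℤ c +ℤ b *ℤ d ≡ c *ℤ a +ℤ d *ℤ b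
  re-comm = ℤ-Solver.solve-∀
  ph-comm : ∀ a b c d → a *ℤ d +ℤ b *ℤ c +ℤ b *ℤ d ≡ c *ℤ b +ℤ d *ℤ a +ℤ d *ℤ b
  ph-comm = ℤ-Solver.solve-∀

⊗-identityˡ : ∀ x → 𝟙 ⊗ x ≡ x
⊗-identityˡ (a + b φ) = cong₂ _+_φ (re-identity a b) (ph-identity a b)
  where
  re-identity : ∀ a b → 1ℤ *ℤ a +ℤ 0ℤ *ℤ b ≡ a
  re-identity = ℤ-Solver.solve-∀
  ph-identity : ∀ a b → 1ℤ *ℤ b +ℤ 0ℤ *ℤ a +ℤ 0ℤ *ℤ b ≡ b
  ph-identity = ℤ-Solver.solve-∀

⊗-identityʳ : ∀ x → x ⊗ 𝟙 ≡ x
⊗-identityʳ x = trans (⊗-comm x 𝟙) (⊗-identityˡ x)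

⊗-distribˡ-⊕ : ∀ x y z → x ⊗ (y ⊕ z) ≡ (x ⊗ y) ⊕ (x ⊗ z)
⊗-distribˡ-⊕ (a + b φ) (c + d φ) (e + f φ) = cong₂ _+_φ (re-distrib a b c d e f) (ph-distrib a b c d e f)
  where
  re-distrib : ∀ a b c d e f → a *ℤ (c +ℤ e) +ℤ b *ℤ (d +ℤ f) ≡ (a *ℤ c +ℤ b *ℤ d) +ℤ (a *ℤ e +ℤ b *ℤ f)
  re-distrib = ℤ-Solver.solve-∀
  ph-distrib : ∀ a b c d e f →
    a *ℤ (d +ℤ f) +ℤ b *ℤ (c +ℤ e) +ℤ b *ℤ (d +ℤ f) ≡ (a *ℤ d +ℤ b *ℤ c +ℤ b *ℤ d) +ℤ (a *ℤ f +ℤ b *ℤ e +ℤ b *ℤ f)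
  ph-distrib = ℤ-Solver.solve-∀

⊗-distribʳ-⊕ : ∀ x y z → (y ⊕ z) ⊗ x ≡ (y ⊗ x) ⊕ (z ⊗ x)
⊗-distribʳ-⊕ x y z = begin
  (y ⊕ z) ⊗ x      ≡⟨ ⊗-comm (y ⊕ z) x ⟩
  x ⊗ (y ⊕ z)      ≡⟨ ⊗-distribˡ-⊕ x y z ⟩
  x ⊗ y ⊕ x ⊗ z    ≡⟨ cong₂ _⊕_ (⊗-comm x y) (⊗-comm x z) ⟩
  y ⊗ x ⊕ z ⊗ x    ∎
  where open ≡-Reasoning

⊕-⊗-isCommutativeRing : IsCommutativeRing _⊕_ _⊗_ ⊝_ 𝟘 𝟙
⊕-⊗-isCommutativeRing = record
  { isRing = record
    { +-isAbelianGroup = record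
      { isGroup = record
        { isMonoid = record
          { isSemigroup = record
            { isMagma = record { isEquivalence = isEquivalence ; ∙-cong = cong₂ _⊕_ }
            ; assoc = ⊕-assoc }
          ; identity = ⊕-identityˡ , ⊕-identityʳ }
        ; inverse = ⊝-inverseˡ , ⊝-inverseʳ
        ; ⁻¹-cong = cong ⊝_ }
      ; comm = ⊕-comm }
    ; *-cong = cong₂ _⊗_
    ; *-assoc = ⊗-assoc
    ; *-identity = ⊗-identityˡ , ⊗-identityʳ
    ; distrib = ⊗-distribˡ-⊕ , ⊗-distribʳ-⊕ }
  ; *-comm = ⊗-comm }

⊕-⊗-commutativeRing : CommutativeRing 0ℓ 0ℓ
⊕-⊗-commutativeRing = record { isCommutativeRing = ⊕-⊗-isCommutativeRing }

open GroupProperties (CommutativeRing.+-group ⊕-⊗-commutativeRing)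
  using (∙-cancelˡ; inverseˡ-unique)

Zφ-ring : ACR.AlmostCommutativeRing 0ℓ 0ℓ
Zφ-ring = ACR.fromCommutativeRing ⊕-⊗-commutativeRing 𝟘≟_
  where
  𝟘≟_ : ∀ x → Maybe (𝟘 ≡ x)
  𝟘≟ ((+ 0) + (+ 0) φ) = just refl
  𝟘≟ _                 = nothing

ι : ℤ → Zφ
ι n = n + 0ℤ φ

⟨_⟩ : ℕ → Zφ
⟨ n ⟩ = ι (+ n)

ι-* : ∀ x y → ι (x *ℤ y) ≡ ι x ⊗ ι y
ι-* x y = cong₂ _+_φ (re-* x y) (ph-* x y)
  where
  re-* : ∀ x y → x *ℤ y ≡ x *ℤ y +ℤ 0ℤ *ℤ 0ℤ
  re-* = ℤ-Solver.solve-∀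
  ph-* : ∀ x y → 0ℤ ≡ x *ℤ 0ℤ +ℤ 0ℤ *ℤ y +ℤ 0ℤ *ℤ 0ℤ
  ph-* = ℤ-Solver.solve-∀

⟨⟩-* : ∀ m n → ⟨ m * n ⟩ ≡ ⟨ m ⟩ ⊗ ⟨ n ⟩
⟨⟩-* m n = trans (cong ι (ℤ.pos-* m n)) (ι-* (+ m) (+ n))

ι-⊕-φ : ∀ x y → ι x ⊕ ι y ⊗ φ ≡ x + y φ
ι-⊕-φ x y = cong₂ _+_φ (re-φ x y) (ph-φ y)
  where
  re-φ : ∀ x y → x +ℤ (y *ℤ 0ℤ +ℤ 0ℤ *ℤ 1ℤ) ≡ x
  re-φ = ℤ-Solver.solve-∀
  ph-φ : ∀ y → 0ℤ +ℤ (y *ℤ 1ℤ +ℤ 0ℤ *ℤ 0ℤ +ℤ 0ℤ *ℤ 1ℤ) ≡ y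
  ph-φ = ℤ-Solver.solve-∀

ι-*-φ : ∀ x y → 0ℤ + (x *ℤ y) φ ≡ ι x ⊗ (ι y ⊗ φ)
ι-*-φ x y = cong₂ _+_φ (re-φ x y) (ph-φ x y)
  where
  re-φ : ∀ x y → 0ℤ ≡ x *ℤ (y *ℤ 0ℤ +ℤ 0ℤ *ℤ 1ℤ) +ℤ 0ℤ *ℤ (y *ℤ 1ℤ +ℤ 0ℤ *ℤ 0ℤ +ℤ 0ℤ *ℤ 1ℤ)
  re-φ = ℤ-Solver.solve-∀
  ph-φ : ∀ x y → x *ℤ y ≡ x *ℤ (y *ℤ 1ℤ +ℤ 0ℤ *ℤ 0ℤ +ℤ 0ℤ *ℤ 1ℤ) +ℤ 0ℤ *ℤ (y *ℤ 0ℤ +ℤ 0ℤ *ℤ 1ℤ)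
                           +ℤ 0ℤ *ℤ (y *ℤ 1ℤ +ℤ 0ℤ *ℤ 0ℤ +ℤ 0ℤ *ℤ 1ℤ)
  ph-φ = ℤ-Solver.solve-∀

⟨⟩-*-cancelˡ : ∀ m {y} .{{_ : NonZero m}} → ⟨ m ⟩ ⊗ y ≡ 𝟘 → y ≡ 𝟘
⟨⟩-*-cancelˡ m {y₁ + y₂ φ} eq =
  cong₂ _+_φ (cancel y₁ (trans (re-* (+ m) y₁ y₂) (cong re eq)))
             (cancel y₂ (trans (ph-* (+ m) y₁ y₂) (cong ph eq)))
  where
  re-* : ∀ k y₁ y₂ → k *ℤ y₁ ≡ k *ℤ y₁ +ℤ 0ℤ *ℤ y₂
  re-* = ℤ-Solver.solve-∀
  ph-* : ∀ k y₁ y₂ → k *ℤ y₂ ≡ k *ℤ y₂ +ℤ 0ℤ *ℤ y₁ +ℤ 0ℤ *ℤ y₂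
  ph-* = ℤ-Solver.solve-∀
  cancel : ∀ y → + m *ℤ y ≡ 0ℤ → y ≡ 0ℤ
  cancel y m*y≡0 with ℤ.i*j≡0⇒i≡0∨j≡0 (+ m) m*y≡0
  ... | inj₁ m≡0 = contradiction (ℤ.+-injective m≡0) (≢-nonZero⁻¹ m)
  ... | inj₂ y≡0 = y≡0

infixl 6 _⊞_
infixr 7 _⊡_

_⊞_ : M₂ → M₂ → M₂
mat x₁ x₂ x₃ x₄ ⊞ mat y₁ y₂ y₃ y₄ = mat (x₁ ⊕ y₁) (x₂ ⊕ y₂) (x₃ ⊕ y₃) (x₄ ⊕ y₄)

_⊡_ : Zφ → M₂ → M₂
k ⊡ mat x₁ x₂ x₃ x₄ = mat (k ⊗ x₁) (k ⊗ x₂) (k ⊗ x₃) (k ⊗ x₄)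

𝟎 : M₂
𝟎 = mat 𝟘 𝟘 𝟘 𝟘

scalar : Zφ → M₂
scalar u = mat u 𝟘 𝟘 u

E : Zφ → M₂
E x = mat 𝟙 x 𝟘 𝟙

traceless : Zφ → Zφ → Zφ → M₂
traceless x y z = mat (⊝ z) x y z

conjE₁₂ : M₂ → M₂
conjE₁₂ (mat α _ γ _) = mat (⊝ (α ⊗ γ)) (α ⊗ α) (⊝ (γ ⊗ γ)) (α ⊗ γ)

mat-cong : ∀ {x₁ x₂ x₃ x₄ y₁ y₂ y₃ y₄} → x₁ ≡ y₁ → x₂ ≡ y₂ → x₃ ≡ y₃ → x₄ ≡ y₄ →
           mat x₁ x₂ x₃ x₄ ≡ mat y₁ y₂ y₃ y₄
mat-cong refl refl refl refl = refl

⊞-⊡-𝟎 : ∀ x c → x ⊞ c ⊡ 𝟎 ≡ x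
⊞-⊡-𝟎 (mat x₁ x₂ x₃ x₄) c = mat-cong (e x₁ c) (e x₂ c) (e x₃ c) (e x₄ c)
  where
  e : ∀ x c → x ⊕ c ⊗ 𝟘 ≡ x
  e = solve-∀ Zφ-ring

⊞-⊡-⊝ : ∀ x c W → (x ⊞ c ⊡ W) ⊞ c ⊡ (⊝ 𝟙 ⊡ W) ≡ x
⊞-⊡-⊝ (mat x₁ x₂ x₃ x₄) c (mat w₁ w₂ w₃ w₄) = mat-cong (e x₁ c w₁) (e x₂ c w₂) (e x₃ c w₃) (e x₄ c w₄)
  where
  e : ∀ x c w → (x ⊕ c ⊗ w) ⊕ c ⊗ (⊝ 𝟙 ⊗ w) ≡ x
  e = solve-∀ Zφ-ring

⊞-⊡-⊞ : ∀ x c V W → (x ⊞ c ⊡ V) ⊞ c ⊡ W ≡ x ⊞ c ⊡ (V ⊞ W)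
⊞-⊡-⊞ (mat x₁ x₂ x₃ x₄) c (mat v₁ v₂ v₃ v₄) (mat w₁ w₂ w₃ w₄) =
  mat-cong (e x₁ c v₁ w₁) (e x₂ c v₂ w₂) (e x₃ c v₃ w₃) (e x₄ c v₄ w₄)
  where
  e : ∀ x c v w → (x ⊕ c ⊗ v) ⊕ c ⊗ w ≡ x ⊕ c ⊗ (v ⊕ w)
  e = solve-∀ Zφ-ring

⊞-⊡-⊞-⊡ : ∀ x c d Y W → x ⊞ c ⊡ (Y ⊞ d ⊡ W) ≡ (x ⊞ c ⊡ Y) ⊞ (c ⊗ d) ⊡ W
⊞-⊡-⊞-⊡ (mat x₁ x₂ x₃ x₄) c d (mat y₁ y₂ y₃ y₄) (mat w₁ w₂ w₃ w₄) =
  mat-cong (e x₁ c d y₁ w₁) (e x₂ c d y₂ w₂) (e x₃ c d y₃ w₃) (e x₄ c d y₄ w₄)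
  where
  e : ∀ x c d y w → x ⊕ c ⊗ (y ⊕ d ⊗ w) ≡ (x ⊕ c ⊗ y) ⊕ (c ⊗ d) ⊗ w
  e = solve-∀ Zφ-ring

⊡-assoc : ∀ u v X → (u ⊗ v) ⊡ X ≡ u ⊡ (v ⊡ X)
⊡-assoc u v (mat x₁ x₂ x₃ x₄) = mat-cong (⊗-assoc u v x₁) (⊗-assoc u v x₂) (⊗-assoc u v x₃) (⊗-assoc u v x₄)

⊡-identityˡ : ∀ X → 𝟙 ⊡ X ≡ X
⊡-identityˡ (mat x₁ x₂ x₃ x₄) = mat-cong (⊗-identityˡ x₁) (⊗-identityˡ x₂) (⊗-identityˡ x₃) (⊗-identityˡ x₄)

⊡-distribˡ-⊞ : ∀ c X Y → c ⊡ (X ⊞ Y) ≡ c ⊡ X ⊞ c ⊡ Y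
⊡-distribˡ-⊞ c (mat x₁ x₂ x₃ x₄) (mat y₁ y₂ y₃ y₄) =
  mat-cong (⊗-distribˡ-⊕ c x₁ y₁) (⊗-distribˡ-⊕ c x₂ y₂) (⊗-distribˡ-⊕ c x₃ y₃) (⊗-distribˡ-⊕ c x₄ y₄)

𝟙⊕-⊡ : ∀ c X → (𝟙 ⊕ c) ⊡ X ≡ X ⊞ c ⊡ X
𝟙⊕-⊡ c (mat x₁ x₂ x₃ x₄) = mat-cong (e c x₁) (e c x₂) (e c x₃) (e c x₄)
  where
  e : ∀ c x → (𝟙 ⊕ c) ⊗ x ≡ x ⊕ c ⊗ x
  e = solve-∀ Zφ-ring

⊡-+φ-split : ∀ x₁ x₂ c D → ι x₁ ⊡ (c ⊡ D) ⊞ ι x₂ ⊡ (c ⊡ (φ ⊡ D)) ≡ c ⊡ ((x₁ + x₂ φ) ⊡ D)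
⊡-+φ-split x₁ x₂ c (mat d₁ d₂ d₃ d₄) = trans
  (mat-cong (e (ι x₁) (ι x₂) c d₁) (e (ι x₁) (ι x₂) c d₂) (e (ι x₁) (ι x₂) c d₃) (e (ι x₁) (ι x₂) c d₄))
  (cong (λ u → c ⊡ (u ⊡ mat d₁ d₂ d₃ d₄)) (ι-⊕-φ x₁ x₂))
  where
  e : ∀ u v c d → u ⊗ (c ⊗ d) ⊕ v ⊗ (c ⊗ (φ ⊗ d)) ≡ c ⊗ ((u ⊕ v ⊗ φ) ⊗ d)
  e = solve-∀ Zφ-ring

traceless-basis : ∀ x y z →
  traceless x y z ≡ x ⊡ traceless 𝟙 𝟘 𝟘 ⊞ y ⊡ traceless 𝟘 𝟙 𝟘 ⊞ z ⊡ traceless 𝟘 𝟘 𝟙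
traceless-basis x y z = mat-cong (e₁₁ x y z) (e₁₂ x y z) (e₂₁ x y z) (e₂₂ x y z)
  where
  e₁₁ : ∀ x y z → ⊝ z ≡ x ⊗ ⊝ 𝟘 ⊕ y ⊗ ⊝ 𝟘 ⊕ z ⊗ ⊝ 𝟙
  e₁₁ = solve-∀ Zφ-ring
  e₁₂ : ∀ x y z → x ≡ x ⊗ 𝟙 ⊕ y ⊗ 𝟘 ⊕ z ⊗ 𝟘
  e₁₂ = solve-∀ Zφ-ring
  e₂₁ : ∀ x y z → y ≡ x ⊗ 𝟘 ⊕ y ⊗ 𝟙 ⊕ z ⊗ 𝟘
  e₂₁ = solve-∀ Zφ-ring
  e₂₂ : ∀ x y z → z ≡ x ⊗ 𝟘 ⊕ y ⊗ 𝟘 ⊕ z ⊗ 𝟙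
  e₂₂ = solve-∀ Zφ-ring

·-distribˡ-⊞⊡ : ∀ L X c Z → L · (X ⊞ c ⊡ Z) ≡ L · X ⊞ c ⊡ (L · Z)
·-distribˡ-⊞⊡ (mat l₁ l₂ l₃ l₄) (mat x₁ x₂ x₃ x₄) c (mat z₁ z₂ z₃ z₄) =
  mat-cong (e l₁ l₂ x₁ x₃ c z₁ z₃) (e l₁ l₂ x₂ x₄ c z₂ z₄) (e l₃ l₄ x₁ x₃ c z₁ z₃) (e l₃ l₄ x₂ x₄ c z₂ z₄)
  where
  e : ∀ l l′ x x′ c z z′ →
      l ⊗ (x ⊕ c ⊗ z) ⊕ l′ ⊗ (x′ ⊕ c ⊗ z′) ≡ (l ⊗ x ⊕ l′ ⊗ x′) ⊕ c ⊗ (l ⊗ z ⊕ l′ ⊗ z′)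
  e = solve-∀ Zφ-ring

·-distribʳ-⊞⊡ : ∀ R X c Z → (X ⊞ c ⊡ Z) · R ≡ X · R ⊞ c ⊡ (Z · R)
·-distribʳ-⊞⊡ (mat r₁ r₂ r₃ r₄) (mat x₁ x₂ x₃ x₄) c (mat z₁ z₂ z₃ z₄) =
  mat-cong (e r₁ r₃ x₁ x₂ c z₁ z₂) (e r₂ r₄ x₁ x₂ c z₁ z₂) (e r₁ r₃ x₃ x₄ c z₃ z₄) (e r₂ r₄ x₃ x₄ c z₃ z₄)
  where
  e : ∀ r r′ x x′ c z z′ →
      (x ⊕ c ⊗ z) ⊗ r ⊕ (x′ ⊕ c ⊗ z′) ⊗ r′ ≡ (x ⊗ r ⊕ x′ ⊗ r′) ⊕ c ⊗ (z ⊗ r ⊕ z′ ⊗ r′)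
  e = solve-∀ Zφ-ring

det-· : ∀ x y → det (x · y) ≡ det x ⊗ det y
det-· (mat x₁ x₂ x₃ x₄) (mat y₁ y₂ y₃ y₄) = e x₁ x₂ x₃ x₄ y₁ y₂ y₃ y₄
  where
  e : ∀ x₁ x₂ x₃ x₄ y₁ y₂ y₃ y₄ →
      (x₁ ⊗ y₁ ⊕ x₂ ⊗ y₃) ⊗ (x₃ ⊗ y₂ ⊕ x₄ ⊗ y₄) ⊖ (x₁ ⊗ y₂ ⊕ x₂ ⊗ y₄) ⊗ (x₃ ⊗ y₁ ⊕ x₄ ⊗ y₃) ≡
      (x₁ ⊗ x₄ ⊖ x₂ ⊗ x₃) ⊗ (y₁ ⊗ y₄ ⊖ y₂ ⊗ y₃)
  e = solve-∀ Zφ-ring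

det-adj : ∀ x → det (adj x) ≡ det x
det-adj (mat x₁ x₂ x₃ x₄) = e x₁ x₂ x₃ x₄
  where
  e : ∀ x₁ x₂ x₃ x₄ → x₄ ⊗ x₁ ⊖ (⊝ x₂) ⊗ (⊝ x₃) ≡ x₁ ⊗ x₄ ⊖ x₂ ⊗ x₃
  e = solve-∀ Zφ-ring

adj-· : ∀ x → adj x · x ≡ scalar (det x)
adj-· (mat x₁ x₂ x₃ x₄) = mat-cong (e₁₁ x₁ x₂ x₃ x₄) (e₁₂ x₂ x₄) (e₂₁ x₁ x₃) (e₂₂ x₁ x₂ x₃ x₄)
  where
  e₁₁ : ∀ x₁ x₂ x₃ x₄ → x₄ ⊗ x₁ ⊕ (⊝ x₂) ⊗ x₃ ≡ x₁ ⊗ x₄ ⊖ x₂ ⊗ x₃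
  e₁₁ = solve-∀ Zφ-ring
  e₁₂ : ∀ x₂ x₄ → x₄ ⊗ x₂ ⊕ (⊝ x₂) ⊗ x₄ ≡ 𝟘
  e₁₂ = solve-∀ Zφ-ring
  e₂₁ : ∀ x₁ x₃ → (⊝ x₃) ⊗ x₁ ⊕ x₁ ⊗ x₃ ≡ 𝟘
  e₂₁ = solve-∀ Zφ-ring
  e₂₂ : ∀ x₁ x₂ x₃ x₄ → (⊝ x₃) ⊗ x₂ ⊕ x₁ ⊗ x₄ ≡ x₁ ⊗ x₄ ⊖ x₂ ⊗ x₃
  e₂₂ = solve-∀ Zφ-ring

·-adj-· : ∀ x y → x · (adj x · y) ≡ det x ⊡ y
·-adj-· (mat x₁ x₂ x₃ x₄) (mat y₁ y₂ y₃ y₄) =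
  mat-cong (e₁ x₁ x₂ x₃ x₄ y₁ y₃) (e₁ x₁ x₂ x₃ x₄ y₂ y₄) (e₂ x₁ x₂ x₃ x₄ y₁ y₃) (e₂ x₁ x₂ x₃ x₄ y₂ y₄)
  where
  e₁ : ∀ x₁ x₂ x₃ x₄ y y′ → x₁ ⊗ (x₄ ⊗ y ⊕ (⊝ x₂) ⊗ y′) ⊕ x₂ ⊗ ((⊝ x₃) ⊗ y ⊕ x₁ ⊗ y′) ≡ (x₁ ⊗ x₄ ⊖ x₂ ⊗ x₃) ⊗ y
  e₁ = solve-∀ Zφ-ring
  e₂ : ∀ x₁ x₂ x₃ x₄ y y′ → x₃ ⊗ (x₄ ⊗ y ⊕ (⊝ x₂) ⊗ y′) ⊕ x₄ ⊗ ((⊝ x₃) ⊗ y ⊕ x₁ ⊗ y′) ≡ (x₁ ⊗ x₄ ⊖ x₂ ⊗ x₃) ⊗ y′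
  e₂ = solve-∀ Zφ-ring

·-E-·-adj : ∀ x t → (x · E t) · adj x ≡ scalar (det x) ⊞ t ⊡ conjE₁₂ x
·-E-·-adj (mat x₁ x₂ x₃ x₄) t = mat-cong (e₁₁ x₁ x₂ x₃ x₄ t) (e₁₂ x₁ x₂ t) (e₂₁ x₃ x₄ t) (e₂₂ x₁ x₂ x₃ x₄ t)
  where
  e₁₁ : ∀ x₁ x₂ x₃ x₄ t →
        (x₁ ⊗ 𝟙 ⊕ x₂ ⊗ 𝟘) ⊗ x₄ ⊕ (x₁ ⊗ t ⊕ x₂ ⊗ 𝟙) ⊗ (⊝ x₃) ≡ (x₁ ⊗ x₄ ⊖ x₂ ⊗ x₃) ⊕ t ⊗ ⊝ (x₁ ⊗ x₃)
  e₁₁ = solve-∀ Zφ-ring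
  e₁₂ : ∀ x₁ x₂ t → (x₁ ⊗ 𝟙 ⊕ x₂ ⊗ 𝟘) ⊗ (⊝ x₂) ⊕ (x₁ ⊗ t ⊕ x₂ ⊗ 𝟙) ⊗ x₁ ≡ 𝟘 ⊕ t ⊗ (x₁ ⊗ x₁)
  e₁₂ = solve-∀ Zφ-ring
  e₂₁ : ∀ x₃ x₄ t → (x₃ ⊗ 𝟙 ⊕ x₄ ⊗ 𝟘) ⊗ x₄ ⊕ (x₃ ⊗ t ⊕ x₄ ⊗ 𝟙) ⊗ (⊝ x₃) ≡ 𝟘 ⊕ t ⊗ ⊝ (x₃ ⊗ x₃)
  e₂₁ = solve-∀ Zφ-ring
  e₂₂ : ∀ x₁ x₂ x₃ x₄ t →
        (x₃ ⊗ 𝟙 ⊕ x₄ ⊗ 𝟘) ⊗ (⊝ x₂) ⊕ (x₃ ⊗ t ⊕ x₄ ⊗ 𝟙) ⊗ x₁ ≡ (x₁ ⊗ x₄ ⊖ x₂ ⊗ x₃) ⊕ t ⊗ (x₁ ⊗ x₃)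
  e₂₂ = solve-∀ Zφ-ring

I⊞⊡-·-I⊞⊡ : ∀ c X Y → (I₂ ⊞ c ⊡ X) · (I₂ ⊞ c ⊡ Y) ≡ (I₂ ⊞ c ⊡ (X ⊞ Y)) ⊞ (c ⊗ c) ⊡ (X · Y)
I⊞⊡-·-I⊞⊡ c (mat x₁ x₂ x₃ x₄) (mat y₁ y₂ y₃ y₄) =
  mat-cong (diag c x₁ x₂ y₁ y₃) (off c x₁ x₂ y₂ y₄) (off′ c x₃ x₄ y₁ y₃) (diag′ c x₃ x₄ y₂ y₄)
  where
  diag : ∀ c x x′ y y′ → (𝟙 ⊕ c ⊗ x) ⊗ (𝟙 ⊕ c ⊗ y) ⊕ (𝟘 ⊕ c ⊗ x′) ⊗ (𝟘 ⊕ c ⊗ y′) ≡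
                         (𝟙 ⊕ c ⊗ (x ⊕ y)) ⊕ (c ⊗ c) ⊗ (x ⊗ y ⊕ x′ ⊗ y′)
  diag = solve-∀ Zφ-ring
  off : ∀ c x x′ y y′ → (𝟙 ⊕ c ⊗ x) ⊗ (𝟘 ⊕ c ⊗ y) ⊕ (𝟘 ⊕ c ⊗ x′) ⊗ (𝟙 ⊕ c ⊗ y′) ≡
                        (𝟘 ⊕ c ⊗ (x′ ⊕ y)) ⊕ (c ⊗ c) ⊗ (x ⊗ y ⊕ x′ ⊗ y′)
  off = solve-∀ Zφ-ring
  off′ : ∀ c x x′ y y′ → (𝟘 ⊕ c ⊗ x) ⊗ (𝟙 ⊕ c ⊗ y) ⊕ (𝟙 ⊕ c ⊗ x′) ⊗ (𝟘 ⊕ c ⊗ y′) ≡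
                         (𝟘 ⊕ c ⊗ (x ⊕ y′)) ⊕ (c ⊗ c) ⊗ (x ⊗ y ⊕ x′ ⊗ y′)
  off′ = solve-∀ Zφ-ring
  diag′ : ∀ c x x′ y y′ → (𝟘 ⊕ c ⊗ x) ⊗ (𝟘 ⊕ c ⊗ y) ⊕ (𝟙 ⊕ c ⊗ x′) ⊗ (𝟙 ⊕ c ⊗ y′) ≡
                          (𝟙 ⊕ c ⊗ (x′ ⊕ y′)) ⊕ (c ⊗ c) ⊗ (x ⊗ y ⊕ x′ ⊗ y′)
  diag′ = solve-∀ Zφ-ring

E-⊕ : ∀ x y → E x · E y ≡ E (x ⊕ y)
E-⊕ x y = mat-cong (e₁₁ x) (e₁₂ x y) refl (e₂₂ y)
  where
  e₁₁ : ∀ x → 𝟙 ⊗ 𝟙 ⊕ x ⊗ 𝟘 ≡ 𝟙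
  e₁₁ = solve-∀ Zφ-ring
  e₁₂ : ∀ x y → 𝟙 ⊗ y ⊕ x ⊗ 𝟙 ≡ x ⊕ y
  e₁₂ = solve-∀ Zφ-ring
  e₂₂ : ∀ y → 𝟘 ⊗ y ⊕ 𝟙 ⊗ 𝟙 ≡ 𝟙
  e₂₂ = solve-∀ Zφ-ring

det-I⊞⊡ : ∀ c X → det (I₂ ⊞ c ⊡ X) ≡ 𝟙 ⊕ c ⊗ (a X ⊕ (d X ⊕ c ⊗ det X))
det-I⊞⊡ c (mat x₁ x₂ x₃ x₄) = e c x₁ x₂ x₃ x₄
  where
  e : ∀ c x₁ x₂ x₃ x₄ → (𝟙 ⊕ c ⊗ x₁) ⊗ (𝟙 ⊕ c ⊗ x₄) ⊖ (𝟘 ⊕ c ⊗ x₂) ⊗ (𝟘 ⊕ c ⊗ x₃) ≡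
                        𝟙 ⊕ c ⊗ (x₁ ⊕ (x₄ ⊕ c ⊗ (x₁ ⊗ x₄ ⊖ x₂ ⊗ x₃)))
  e = solve-∀ Zφ-ring

infix 4 _≈_[_]

record _≈_[_] (x y : M₂) (m : ℕ) : Set where
  constructor congruent
  field
    quotient : M₂
    equality : x ≡ y ⊞ ⟨ m ⟩ ⊡ quotient

≈-⊞⊡ : ∀ x W → x ⊞ ⟨ m ⟩ ⊡ W ≈ x [ m ]
≈-⊞⊡ x W = congruent W refl

≈-refl : x ≈ x [ m ]
≈-refl {x} {m} = congruent 𝟎 (sym (⊞-⊡-𝟎 x ⟨ m ⟩))

≈-reflexive : x ≡ y → x ≈ y [ m ]
≈-reflexive refl = ≈-refl

≈-sym : x ≈ y [ m ] → y ≈ x [ m ]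
≈-sym {y = y} {m} (congruent W refl) = congruent (⊝ 𝟙 ⊡ W) (sym (⊞-⊡-⊝ y ⟨ m ⟩ W))

≈-trans : x ≈ y [ m ] → y ≈ z [ m ] → x ≈ z [ m ]
≈-trans {m = m} {z = z} (congruent W refl) (congruent V refl) = congruent (V ⊞ W) (⊞-⊡-⊞ z ⟨ m ⟩ V W)

≈-setoid : ℕ → Setoid 0ℓ 0ℓ
≈-setoid m = record
  { Carrier = M₂
  ; _≈_ = _≈_[ m ]
  ; isEquivalence = record { refl = ≈-refl ; sym = ≈-sym ; trans = ≈-trans }
  }

≈-weaken : m ∣ n → x ≈ y [ n ] → x ≈ y [ m ]
≈-weaken {m} {y = y} (divides k refl) (congruent W refl) = congruent (⟨ k ⟩ ⊡ W) (cong (y ⊞_) (begin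
  ⟨ k * m ⟩ ⊡ W          ≡⟨ cong (_⊡ W) (trans (⟨⟩-* k m) (⊗-comm ⟨ k ⟩ ⟨ m ⟩)) ⟩
  (⟨ m ⟩ ⊗ ⟨ k ⟩) ⊡ W    ≡⟨ ⊡-assoc ⟨ m ⟩ ⟨ k ⟩ W ⟩
  ⟨ m ⟩ ⊡ (⟨ k ⟩ ⊡ W)    ∎))
  where open ≡-Reasoning

≈-·ˡ : ∀ x → y ≈ y′ [ m ] → x · y ≈ x · y′ [ m ]
≈-·ˡ {y′ = y′} {m} x (congruent W refl) = congruent (x · W) (·-distribˡ-⊞⊡ x y′ ⟨ m ⟩ W)

≈-·ʳ : ∀ y → x ≈ x′ [ m ] → x · y ≈ x′ · y [ m ]
≈-·ʳ {x′ = x′} {m} y (congruent W refl) = congruent (W · y) (·-distribʳ-⊞⊡ y x′ ⟨ m ⟩ W)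

≈-· : ∀ {x x′ y y′} → x ≈ x′ [ m ] → y ≈ y′ [ m ] → x · y ≈ x′ · y′ [ m ]
≈-· {x′ = x′} {y} x≈x′ y≈y′ = ≈-trans (≈-·ʳ y x≈x′) (≈-·ˡ x′ y≈y′)

≈-⊞⊡-cong : ∀ m z → x ≈ y [ n ] → z ⊞ ⟨ m ⟩ ⊡ x ≈ z ⊞ ⟨ m ⟩ ⊡ y [ m * n ]
≈-⊞⊡-cong {y = y} {n} m z (congruent W refl) =
  congruent W (trans (⊞-⊡-⊞-⊡ z ⟨ m ⟩ ⟨ n ⟩ y W) (cong (λ u → (z ⊞ ⟨ m ⟩ ⊡ y) ⊞ u ⊡ W) (sym (⟨⟩-* m n))))

≡[φ]⇒ : ∀ {q} x y → x ≡[φ] y mod q → Σ Zφ λ w → x ≡ y ⊕ ⟨ q ⟩ ⊗ w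
≡[φ]⇒ {q} (x₁ + x₂ φ) (y₁ + y₂ φ) (e₁ , e₂)
  with ℤ∣.divides k₁ eq₁ ← ℤ∣.∣ᵤ⇒∣ e₁ | ℤ∣.divides k₂ eq₂ ← ℤ∣.∣ᵤ⇒∣ e₂
  = k₁ + k₂ φ , cong₂ _+_φ (re-≡ x₁ y₁ k₁ k₂ (+ q) eq₁) (ph-≡ x₂ y₂ k₁ k₂ (+ q) eq₂)
  where
  x≡y+[x-y] : ∀ x y → x ≡ y +ℤ (x -ℤ y)
  x≡y+[x-y] = ℤ-Solver.solve-∀
  re-≡ : ∀ x y k k′ Q → x -ℤ y ≡ k *ℤ Q → x ≡ y +ℤ (Q *ℤ k +ℤ 0ℤ *ℤ k′)
  re-≡ x y k k′ Q eq = trans (x≡y+[x-y] x y) (trans (cong (y +ℤ_) eq) (rhs y k k′ Q))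
    where
    rhs : ∀ y k k′ Q → y +ℤ k *ℤ Q ≡ y +ℤ (Q *ℤ k +ℤ 0ℤ *ℤ k′)
    rhs = ℤ-Solver.solve-∀
  ph-≡ : ∀ x y k k′ Q → x -ℤ y ≡ k′ *ℤ Q → x ≡ y +ℤ (Q *ℤ k′ +ℤ 0ℤ *ℤ k +ℤ 0ℤ *ℤ k′)
  ph-≡ x y k k′ Q eq = trans (x≡y+[x-y] x y) (trans (cong (y +ℤ_) eq) (rhs y k k′ Q))
    where
    rhs : ∀ y k k′ Q → y +ℤ k′ *ℤ Q ≡ y +ℤ (Q *ℤ k′ +ℤ 0ℤ *ℤ k +ℤ 0ℤ *ℤ k′)
    rhs = ℤ-Solver.solve-∀

⇒≡[φ] : ∀ {q} y w → (y ⊕ ⟨ q ⟩ ⊗ w) ≡[φ] y mod q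
⇒≡[φ] {q} (y₁ + y₂ φ) (w₁ + w₂ φ) =
  ℤ∣.∣⇒∣ᵤ (ℤ∣.divides w₁ (re-∣ (+ q) y₁ w₁ w₂)) , ℤ∣.∣⇒∣ᵤ (ℤ∣.divides w₂ (ph-∣ (+ q) y₂ w₁ w₂))
  where
  re-∣ : ∀ Q y w w′ → y +ℤ (Q *ℤ w +ℤ 0ℤ *ℤ w′) -ℤ y ≡ w *ℤ Q
  re-∣ = ℤ-Solver.solve-∀
  ph-∣ : ∀ Q y w w′ → y +ℤ (Q *ℤ w′ +ℤ 0ℤ *ℤ w +ℤ 0ℤ *ℤ w′) -ℤ y ≡ w′ *ℤ Q
  ph-∣ = ℤ-Solver.solve-∀

≡M⇒≈ : x ≡M y mod q → x ≈ y [ q ]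
≡M⇒≈ {mat x₁ x₂ x₃ x₄} {mat y₁ y₂ y₃ y₄} (e₁ , e₂ , e₃ , e₄)
  with w₁ , x₁≡ ← ≡[φ]⇒ x₁ y₁ e₁ | w₂ , x₂≡ ← ≡[φ]⇒ x₂ y₂ e₂
     | w₃ , x₃≡ ← ≡[φ]⇒ x₃ y₃ e₃ | w₄ , x₄≡ ← ≡[φ]⇒ x₄ y₄ e₄
  = congruent (mat w₁ w₂ w₃ w₄) (mat-cong x₁≡ x₂≡ x₃≡ x₄≡)

≈⇒≡M : x ≈ y [ q ] → x ≡M y mod q
≈⇒≡M {y = mat y₁ y₂ y₃ y₄} (congruent (mat w₁ w₂ w₃ w₄) refl) = ⇒≡[φ] y₁ w₁ , ⇒≡[φ] y₂ w₂ , ⇒≡[φ] y₃ w₃ , ⇒≡[φ] y₄ w₄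

module ≈-Reasoning (m : ℕ) = SetoidReasoning (≈-setoid m)

InG-· : InG x → InG y → InG (x · y)
InG-· {x} {y} x∈G y∈G = trans (det-· x y) (cong₂ _⊗_ x∈G y∈G)

InG-adj : InG x → InG (adj x)
InG-adj {x} x∈G = trans (det-adj x) x∈G

Γ⊆G : InΓ x → InG x
Γ⊆G gen₁      = refl
Γ⊆G gen₂      = refl
Γ⊆G gen₃      = refl
Γ⊆G gen₄      = refl
Γ⊆G one       = refl
Γ⊆G (mul {x} {y} p q) = InG-· {x} {y} (Γ⊆G p) (Γ⊆G q)
Γ⊆G (inv {x} p)       = InG-adj {x} (Γ⊆G p)

E-φ∈Γ : ∀ n → InΓ (E (0ℤ + n φ))
E-φ∈Γ (+ k)    = E-kφ∈Γ k
  where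
  E-kφ∈Γ : ∀ k → InΓ (E (0ℤ + + k φ))
  E-kφ∈Γ zero    = one
  E-kφ∈Γ (suc k) = subst InΓ (E-⊕ φ (0ℤ + + k φ)) (mul gen₁ (E-kφ∈Γ k))
E-φ∈Γ -[1+ k ] = inv (E-φ∈Γ (+ suc k))

infixl 6 _⊞ₛ_

data Spanned : M₂ → Set where
  gen  : ∀ {γ} → InΓ γ → (t : ℤ) → Spanned ((ι t ⊗ φ) ⊡ conjE₁₂ γ)
  _⊞ₛ_ : Spanned A → Spanned B → Spanned (A ⊞ B)

spanned-scale : Spanned A → ∀ k → Spanned (ι k ⊡ A)
spanned-scale (gen {γ} γ∈Γ t) k = subst Spanned eq (gen γ∈Γ (k *ℤ t))
  where
  open ≡-Reasoning
  eq : (ι (k *ℤ t) ⊗ φ) ⊡ conjE₁₂ γ ≡ ι k ⊡ ((ι t ⊗ φ) ⊡ conjE₁₂ γ)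
  eq = begin
    (ι (k *ℤ t) ⊗ φ) ⊡ conjE₁₂ γ    ≡⟨ cong (λ u → (u ⊗ φ) ⊡ conjE₁₂ γ) (ι-* k t) ⟩
    ((ι k ⊗ ι t) ⊗ φ) ⊡ conjE₁₂ γ   ≡⟨ cong (_⊡ conjE₁₂ γ) (⊗-assoc (ι k) (ι t) φ) ⟩
    (ι k ⊗ (ι t ⊗ φ)) ⊡ conjE₁₂ γ   ≡⟨ ⊡-assoc (ι k) (ι t ⊗ φ) (conjE₁₂ γ) ⟩
    ι k ⊡ ((ι t ⊗ φ) ⊡ conjE₁₂ γ)   ∎
spanned-scale (_⊞ₛ_ {A} {B} s s′) k =
  subst Spanned (sym (⊡-distribˡ-⊞ (ι k) A B)) (spanned-scale s k ⊞ₛ spanned-scale s′ k)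

spanned-Zφ-multiples : ∀ c D → Spanned (c ⊡ D) → Spanned (c ⊡ (φ ⊡ D)) → ∀ x → Spanned (c ⊡ (x ⊡ D))
spanned-Zφ-multiples c D s s′ (x₁ + x₂ φ) =
  subst Spanned (⊡-+φ-split x₁ x₂ c D) (spanned-scale s x₁ ⊞ₛ spanned-scale s′ x₂)

g₁⁻¹g₃g₁⁻¹∈Γ : InΓ ((adj g₁ · g₃) · adj g₁)
g₁⁻¹g₃g₁⁻¹∈Γ = mul (mul (inv gen₁) gen₃) (inv gen₁)

g₃g₁⁻¹∈Γ : InΓ (g₃ · adj g₁)
g₃g₁⁻¹∈Γ = mul gen₃ (inv gen₁)

g₁g₂∈Γ : InΓ (g₁ · g₂)
g₁g₂∈Γ = mul gen₁ gen₂

-- The six matrices φ·γe₁₂γ⁻¹ used here span a sublattice of index 2 in the traceless matrices,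
-- so only twice each basis matrix is reached; this lost factor 2 is why r has to be odd.
spanned-2e₁₂ : Spanned (⟨ 2 ⟩ ⊡ traceless 𝟙 𝟘 𝟘)
spanned-2e₁₂ = gen one (- + 4) ⊞ₛ gen g₁⁻¹g₃g₁⁻¹∈Γ (- + 2) ⊞ₛ gen gen₂ (- + 1)
           ⊞ₛ gen g₃g₁⁻¹∈Γ (+ 2) ⊞ₛ gen (inv gen₂) (+ 1)

spanned-2φe₁₂ : Spanned (⟨ 2 ⟩ ⊡ (φ ⊡ traceless 𝟙 𝟘 𝟘))
spanned-2φe₁₂ = gen one (+ 2)

spanned-2e₂₁ : Spanned (⟨ 2 ⟩ ⊡ traceless 𝟘 𝟙 𝟘)
spanned-2e₂₁ = gen one (+ 2) ⊞ₛ gen g₁⁻¹g₃g₁⁻¹∈Γ (+ 4) ⊞ₛ gen gen₂ (- + 1) ⊞ₛ gen (inv gen₂) (- + 1)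

spanned-2φe₂₁ : Spanned (⟨ 2 ⟩ ⊡ (φ ⊡ traceless 𝟘 𝟙 𝟘))
spanned-2φe₂₁ = gen g₁⁻¹g₃g₁⁻¹∈Γ (- + 2)

spanned-2h : Spanned (⟨ 2 ⟩ ⊡ traceless 𝟘 𝟘 𝟙)
spanned-2h = gen one (- + 2) ⊞ₛ gen g₁⁻¹g₃g₁⁻¹∈Γ (- + 10) ⊞ₛ gen g₃g₁⁻¹∈Γ (+ 10)
         ⊞ₛ gen (inv gen₂) (+ 2) ⊞ₛ gen g₁g₂∈Γ (- + 2)

spanned-2φh : Spanned (⟨ 2 ⟩ ⊡ (φ ⊡ traceless 𝟘 𝟘 𝟙))
spanned-2φh = gen one (+ 2) ⊞ₛ gen g₁⁻¹g₃g₁⁻¹∈Γ (+ 10) ⊞ₛ gen gen₂ (+ 1) ⊞ₛ gen g₃g₁⁻¹∈Γ (- + 10)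
          ⊞ₛ gen (inv gen₂) (- + 3) ⊞ₛ gen g₁g₂∈Γ (+ 2)

twice-traceless-spanned : ∀ x y z → Spanned (⟨ 2 ⟩ ⊡ traceless x y z)
twice-traceless-spanned x y z = subst Spanned eq
  (spanned-Zφ-multiples two e₁₂ spanned-2e₁₂ spanned-2φe₁₂ x
    ⊞ₛ spanned-Zφ-multiples two e₂₁ spanned-2e₂₁ spanned-2φe₂₁ y
    ⊞ₛ spanned-Zφ-multiples two h spanned-2h spanned-2φh z)
  where
  open ≡-Reasoning
  two = ⟨ 2 ⟩
  e₁₂ = traceless 𝟙 𝟘 𝟘
  e₂₁ = traceless 𝟘 𝟙 𝟘
  h = traceless 𝟘 𝟘 𝟙
  eq : two ⊡ (x ⊡ e₁₂) ⊞ two ⊡ (y ⊡ e₂₁) ⊞ two ⊡ (z ⊡ h) ≡ two ⊡ traceless x y z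
  eq = begin
    two ⊡ (x ⊡ e₁₂) ⊞ two ⊡ (y ⊡ e₂₁) ⊞ two ⊡ (z ⊡ h)
      ≡⟨ cong (_⊞ two ⊡ (z ⊡ h)) (sym (⊡-distribˡ-⊞ two (x ⊡ e₁₂) (y ⊡ e₂₁))) ⟩
    two ⊡ (x ⊡ e₁₂ ⊞ y ⊡ e₂₁) ⊞ two ⊡ (z ⊡ h)
      ≡⟨ sym (⊡-distribˡ-⊞ two (x ⊡ e₁₂ ⊞ y ⊡ e₂₁) (z ⊡ h)) ⟩
    two ⊡ (x ⊡ e₁₂ ⊞ y ⊡ e₂₁ ⊞ z ⊡ h)
      ≡⟨ cong (two ⊡_) (sym (traceless-basis x y z)) ⟩
    two ⊡ traceless x y z
      ∎

spanned-suc-odd : ∀ {r} → ¬ 2 ∣ r → ∀ x y z → Spanned (⟨ suc r ⟩ ⊡ traceless x y z)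
spanned-suc-odd {r} r-odd x y z = subst Spanned eq (spanned-scale (twice-traceless-spanned x y z) (+ h))
  where
  open ≡-Reasoning
  h = ⌈ r /2⌉
  eq : ⟨ h ⟩ ⊡ (⟨ 2 ⟩ ⊡ traceless x y z) ≡ ⟨ suc r ⟩ ⊡ traceless x y z
  eq = begin
    ⟨ h ⟩ ⊡ (⟨ 2 ⟩ ⊡ traceless x y z)   ≡⟨ sym (⊡-assoc ⟨ h ⟩ ⟨ 2 ⟩ (traceless x y z)) ⟩
    (⟨ h ⟩ ⊗ ⟨ 2 ⟩) ⊡ traceless x y z   ≡⟨ cong (_⊡ traceless x y z) (sym (⟨⟩-* h 2)) ⟩
    ⟨ h * 2 ⟩ ⊡ traceless x y z          ≡⟨ cong (λ k → ⟨ k ⟩ ⊡ traceless x y z) (sym (odd⇒suc≡⌈/2⌉*2 r-odd)) ⟩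
    ⟨ suc r ⟩ ⊡ traceless x y z          ∎

record Lifts (m : ℕ) (A : M₂) : Set where
  field
    element : M₂
    element∈Γ : InΓ element
    element≈ : element ≈ I₂ ⊞ ⟨ m ⟩ ⊡ A [ m * m ]

spanned⇒lifts : ∀ m → Spanned A → Lifts m A
spanned⇒lifts m (gen {γ} γ∈Γ t) = record
  { element = (γ · E (0ℤ + (+ m *ℤ t) φ)) · adj γ
  ; element∈Γ = mul (mul γ∈Γ (E-φ∈Γ (+ m *ℤ t))) (inv γ∈Γ)
  ; element≈ = ≈-reflexive (begin
      (γ · E (0ℤ + (+ m *ℤ t) φ)) · adj γ
        ≡⟨ ·-E-·-adj γ (0ℤ + (+ m *ℤ t) φ) ⟩
      scalar (det γ) ⊞ (0ℤ + (+ m *ℤ t) φ) ⊡ conjE₁₂ γ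
        ≡⟨ cong₂ (λ u v → scalar u ⊞ v ⊡ conjE₁₂ γ) (Γ⊆G γ∈Γ) (ι-*-φ (+ m) t) ⟩
      I₂ ⊞ (⟨ m ⟩ ⊗ (ι t ⊗ φ)) ⊡ conjE₁₂ γ
        ≡⟨ cong (I₂ ⊞_) (⊡-assoc ⟨ m ⟩ (ι t ⊗ φ) (conjE₁₂ γ)) ⟩
      I₂ ⊞ ⟨ m ⟩ ⊡ ((ι t ⊗ φ) ⊡ conjE₁₂ γ)
        ∎)
  }
  where open ≡-Reasoning
spanned⇒lifts m (_⊞ₛ_ {A} {B} s s′) = record
  { element = γ · γ′
  ; element∈Γ = mul γ∈Γ γ′∈Γ
  ; element≈ = ≈-trans (≈-· γ≈ γ′≈) (congruent (A · B) (trans (I⊞⊡-·-I⊞⊡ ⟨ m ⟩ A B)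
                 (cong (λ u → I₂ ⊞ ⟨ m ⟩ ⊡ (A ⊞ B) ⊞ u ⊡ (A · B)) (sym (⟨⟩-* m m)))))
  }
  where
  open Lifts (spanned⇒lifts m s) renaming (element to γ; element∈Γ to γ∈Γ; element≈ to γ≈)
  open Lifts (spanned⇒lifts m s′) renaming (element to γ′; element∈Γ to γ′∈Γ; element≈ to γ′≈)

InG-I⊞⊡⇒traceless : ∀ m X .{{_ : NonZero m}} → InG (I₂ ⊞ ⟨ m ⟩ ⊡ X) → X ≈ traceless (b X) (c X) (d X) [ m ]
InG-I⊞⊡⇒traceless m X@(mat x₁ x₂ x₃ x₄) det≡1 =
  congruent (mat (⊝ det X) 𝟘 𝟘 𝟘) (mat-cong x₁≡ (x≡x⊕c⊗𝟘 x₂ μ) (x≡x⊕c⊗𝟘 x₃ μ) (x≡x⊕c⊗𝟘 x₄ μ))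
  where
  μ = ⟨ m ⟩
  μ⊗[trace+μ⊗det]≡𝟘 : μ ⊗ (x₁ ⊕ (x₄ ⊕ μ ⊗ det X)) ≡ 𝟘
  μ⊗[trace+μ⊗det]≡𝟘 = ∙-cancelˡ 𝟙 _ 𝟘 (trans (sym (det-I⊞⊡ μ X)) (trans det≡1 (sym (⊕-identityʳ 𝟙))))
  ⊝[x⊕c⊗D] : ∀ x c D → ⊝ (x ⊕ c ⊗ D) ≡ ⊝ x ⊕ c ⊗ ⊝ D
  ⊝[x⊕c⊗D] = solve-∀ Zφ-ring
  x≡x⊕c⊗𝟘 : ∀ x c → x ≡ x ⊕ c ⊗ 𝟘
  x≡x⊕c⊗𝟘 = solve-∀ Zφ-ring
  x₁≡ : x₁ ≡ ⊝ x₄ ⊕ μ ⊗ ⊝ det X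
  x₁≡ = trans (inverseˡ-unique x₁ _ (⟨⟩-*-cancelˡ m μ⊗[trace+μ⊗det]≡𝟘)) (⊝[x⊕c⊗D] x₄ μ (det X))

Γ[_]∋_mod_ : ℕ → M₂ → ℕ → Set
Γ[ m ]∋ g mod n = Σ M₂ λ γ → InΓ γ × γ ≈ I₂ [ m ] × γ ≈ g [ n ]

lift-step : ∀ {r m g} .{{_ : NonZero m}} → ¬ 2 ∣ r → r ∣ m → InG g → g ≈ I₂ [ m ] → Γ[ m ]∋ g mod (m * r)
lift-step {r} {m} r-odd r∣m g∈G (congruent X refl) =
  approximate (spanned⇒lifts m (spanned-suc-odd r-odd (b X) (c X) (d X)))
  where
  X₀ = traceless (b X) (c X) (d X)
  mr∣mm : m * r ∣ m * m
  mr∣mm = *-monoʳ-∣ m r∣m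
  approximate : Lifts m (⟨ suc r ⟩ ⊡ X₀) → Γ[ m ]∋ I₂ ⊞ ⟨ m ⟩ ⊡ X mod (m * r)
  approximate record { element = γ ; element∈Γ = γ∈Γ ; element≈ = γ≈ } =
    γ , γ∈Γ , ≈-trans (≈-weaken (m∣m*n m) γ≈) (≈-⊞⊡ I₂ _) , γ≈g
    where
    γ≈g : γ ≈ I₂ ⊞ ⟨ m ⟩ ⊡ X [ m * r ]
    γ≈g = begin
      γ                                 ≈⟨ ≈-weaken mr∣mm γ≈ ⟩
      I₂ ⊞ ⟨ m ⟩ ⊡ (⟨ suc r ⟩ ⊡ X₀)      ≡⟨ cong (λ A → I₂ ⊞ ⟨ m ⟩ ⊡ A) (𝟙⊕-⊡ ⟨ r ⟩ X₀) ⟩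
      I₂ ⊞ ⟨ m ⟩ ⊡ (X₀ ⊞ ⟨ r ⟩ ⊡ X₀)     ≈⟨ ≈-⊞⊡-cong m I₂ (≈-⊞⊡ {m = r} X₀ X₀) ⟩
      I₂ ⊞ ⟨ m ⟩ ⊡ X₀                   ≈⟨ ≈-sym (≈-weaken mr∣mm (≈-⊞⊡-cong m I₂ (InG-I⊞⊡⇒traceless m X g∈G))) ⟩
      I₂ ⊞ ⟨ m ⟩ ⊡ X                    ∎
      where open ≈-Reasoning (m * r)

adj-·-≈I : ∀ {γ g n} → InΓ γ → γ ≈ g [ n ] → adj γ · g ≈ I₂ [ n ]
adj-·-≈I {γ} {g} {n} γ∈Γ γ≈g =
  subst (adj γ · g ≈_[ n ]) (trans (adj-· γ) (cong scalar (Γ⊆G γ∈Γ))) (≈-·ˡ (adj γ) (≈-sym γ≈g))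

·-adj-·-≈ : ∀ {γ γ′ g n} → InΓ γ → γ′ ≈ adj γ · g [ n ] → γ · γ′ ≈ g [ n ]
·-adj-·-≈ {γ} {γ′} {g} {n} γ∈Γ γ′≈ =
  subst (γ · γ′ ≈_[ n ]) (trans (·-adj-· γ g) (trans (cong (_⊡ g) (Γ⊆G γ∈Γ)) (⊡-identityˡ g))) (≈-·ˡ γ γ′≈)

Γ[]∋-refl : ∀ {m g} → g ≈ I₂ [ m ] → Γ[ m ]∋ g mod m
Γ[]∋-refl g≈I = I₂ , one , ≈-refl , ≈-sym g≈I

Γ[]∋-adj-· : ∀ {m n k g γ} → InΓ γ → γ ≈ I₂ [ m ] → m ∣ n → Γ[ n ]∋ adj γ · g mod k → Γ[ m ]∋ g mod k
Γ[]∋-adj-· γ∈Γ γ≈I m∣n (γ′ , γ′∈Γ , γ′≈I , γ′≈) =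
  _ , mul γ∈Γ γ′∈Γ , ≈-· γ≈I (≈-weaken m∣n γ′≈I) , ·-adj-·-≈ γ∈Γ γ′≈

lift-iterate : ∀ {r m g} .{{_ : NonZero m}} → ¬ 2 ∣ r → r ∣ m → ∀ K → InG g → g ≈ I₂ [ m ] →
               Γ[ m ]∋ g mod (m * r ^ K)
lift-iterate {r} {m} {g} r-odd r∣m zero g∈G g≈I =
  subst (Γ[ m ]∋ g mod_) (sym (ℕ.*-identityʳ m)) (Γ[]∋-refl g≈I)
lift-iterate {r} {m} {g} r-odd r∣m (suc K) g∈G g≈I = recurse (lift-step {g = g} r-odd r∣m g∈G g≈I)
  where
  recurse : Γ[ m ]∋ g mod (m * r) → Γ[ m ]∋ g mod (m * r ^ suc K)
  recurse (γ , γ∈Γ , γ≈I , γ≈g) = subst (Γ[ m ]∋ g mod_) (ℕ.*-assoc m r (r ^ K))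
    (Γ[]∋-adj-· {n = m * r} γ∈Γ γ≈I (m∣m*n r)
      (lift-iterate {g = adj γ · g} {{ℕ.m*n≢0 m r {{it}} {{odd⇒nonZero r-odd}}}} r-odd (n∣m*n m) K
        (InG-· {adj γ} {g} (InG-adj {γ} (Γ⊆G γ∈Γ)) g∈G) (adj-·-≈I γ∈Γ γ≈g)))

lemma3p2 : (s N : ℕ) (p n : Fin N → ℕ) →
    (∀ i → Prime (p i)) → (∀ i → ¬ (2 ∣ p i)) → Injective _≡_ _≡_ p →
    (∀ i → 1 ≤ n i) →
    (q q₀ : ℕ) → q ≡ 2 ^ s * ∏ N (λ i → p i ^ n i) → q₀ ≡ 2 ^ s * ∏ N p →
    -- π_q(Γ(q₀)) ⊆ π_q(G(q₀))
    ((γ : M₂) → InΓ γ → γ ≡M I₂ mod q₀ →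
      Σ M₂ (λ g → InG g × (g ≡M I₂ mod q₀) × (g ≡M γ mod q)))
    ×
    -- π_q(G(q₀)) ⊆ π_q(Γ(q₀))
    ((g : M₂) → InG g → g ≡M I₂ mod q₀ →
      Σ M₂ (λ γ → InΓ γ × (γ ≡M I₂ mod q₀) × (γ ≡M g mod q)))
lemma3p2 s N p n _ p-odd _ _ q q₀ refl refl = Γ-part , G-part
  where
  r = ∏ N p
  r-odd = ∏-odd N p p-odd
  K = ∑ N n
  instance
    q₀≢0 : NonZero q₀
    q₀≢0 = ℕ.m*n≢0 (2 ^ s) r {{ℕ.m^n≢0 2 s}} {{odd⇒nonZero r-odd}}
  q∣q₀rᴷ : q ∣ q₀ * r ^ K
  q∣q₀rᴷ = subst (q ∣_) (sym (ℕ.*-assoc (2 ^ s) r (r ^ K)))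
    (*-monoʳ-∣ (2 ^ s) (∣-trans (∏-^-∣-∏-^ N p n K (≤-∑ N n)) (n∣m*n r)))
  Γ-part : (γ : M₂) → InΓ γ → γ ≡M I₂ mod q₀ → Σ M₂ (λ g → InG g × (g ≡M I₂ mod q₀) × (g ≡M γ mod q))
  Γ-part γ γ∈Γ γ≡I = γ , Γ⊆G γ∈Γ , γ≡I , ≈⇒≡M {γ} {γ} {q} ≈-refl
  G-part : (g : M₂) → InG g → g ≡M I₂ mod q₀ → Σ M₂ (λ γ → InΓ γ × (γ ≡M I₂ mod q₀) × (γ ≡M g mod q))
  G-part g g∈G g≡I = represent (lift-iterate {g = g} r-odd (n∣m*n (2 ^ s)) K g∈G (≡M⇒≈ {g} {I₂} {q₀} g≡I))
    where
    represent : Γ[ q₀ ]∋ g mod (q₀ * r ^ K) → Σ M₂ (λ γ → InΓ γ × (γ ≡M I₂ mod q₀) × (γ ≡M g mod q))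
    represent (γ , γ∈Γ , γ≈I , γ≈g) = γ , γ∈Γ , ≈⇒≡M {γ} {I₂} {q₀} γ≈I , ≈⇒≡M {γ} {g} {q} (≈-weaken q∣q₀rᴷ γ≈g)
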